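{- Let $c'$ be a vector of $d'$ non-negative integers, $k'$ a sparsity parameter and $v$ an integer. Let $w^1 = \text{Dual-Greedy}(c', v)$, $active^1 = \text{Active-Constraints}(c', w^1)$, $w^2 = \text{Dual-Greedy}(c', v+1)$ and $active^2 = \text{Active-Constraints}(c', w^2)$. Then $w^1$ is an optimal solution of $\mathcal{D}(c',k')$ if and only if $|active^1| \ge k' \ge |active^2|$.
   Context: $\Delta$ is a fixed positive integer. $\mathcal{D}(c',k')$ is the LP in variables $w_0 \in \mathbb{R}$, $w_1,\dots,w_{d'}$: minimize $w_0 k' + \sum_{i=1}^{d'} w_i$ subject to $w_0 + \sum_{j=\max\{1,i-\Delta+1\}}^{i} w_j \ge c'_i$ for $i=1,\dots,d'$, and $w_i \ge 0$ for $i \ge 1$. Dual-Greedy$(c',v)$ returns $w$ with $w_0 = v$ and, for $i = 1,\dots,d'$ in increasing order, $w_i = \max\{0,\ c'_i - (w_0 + \sum_{j=\max\{1,i-\Delta+1\}}^{i-1} w_j)\}$. For a feasible $w$ of $\mathcal{D}(c',k')$, Active-Constraints$(c',w)$ is the set produced as follows: set $last = -\infty$ and $active = \emptyset$; for $i = 1,\dots,d'$ in increasing order, if $last \le i - \Delta$ and $c'_i = w_0 + \sum_{j=\max\{1,i-\Delta+1\}}^{i} w_j$ (constraint $i$ is tight), add $i$ to $active$ and set $last = i$.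
   Formalization: The LP $\mathcal{D}(c',k')$ is taken over ℚ: its variables $w_0$ and $w_1,\dots,w_{d'}$ are rational rather than real. -}

module Defs where

open import Data.Nat as ℕ using (ℕ; zero; suc; _∸_; _⊔_)
open import Data.Integer as ℤ using (ℤ; +_)
open import Data.Rational as ℚ using (ℚ; 0ℚ; _/_)
open import Data.Rational.Properties as ℚP using ()
open import Data.List using (List; []; _∷_; map; upTo; take; length; foldl; sum)
open import Data.List as L using ()
open import Data.Vec as V using (Vec)
open import Data.Fin using (Fin)
open import Data.Maybe using (Maybe; just; nothing)
open import Data.Product using (_×_; _,_; proj₁; proj₂)
open import Relation.Nullary using (yes; no)
open import Relation.Nullary.Decidable using (does)
open import Data.Bool using (Bool; true; false; if_then_else_; _∧_)

-- Casts into ℚ (the LP is solved over the ordered field ℚ)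
ℕ→ℚ : ℕ → ℚ
ℕ→ℚ n = + n / 1

ℤ→ℚ : ℤ → ℚ
ℤ→ℚ z = z / 1

sumℚ : List ℚ → ℚ
sumℚ = L.foldr ℚ._+_ 0ℚ

-- The list of integers lo, lo+1, …, hi (empty if hi < lo)
range : ℕ → ℕ → List ℕ
range lo hi = map (λ t → lo ℕ.+ t) (upTo (suc hi ∸ lo))

rangeSum : (ℕ → ℚ) → ℕ → ℕ → ℚ
rangeSum f lo hi = sumℚ (map f (range lo hi))

-- 1-based entry c'_i of a vector c' (i ∈ {1,…,d'}); 0 outside this range
entry : ∀ {d'} → Vec ℕ d' → ℕ → ℕ
entry V.[]       _             = 0
entry (x V.∷ xs) zero          = 0
entry (x V.∷ xs) (suc zero)    = x
entry (x V.∷ xs) (suc (suc i)) = entry xs (suc i)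

-- A candidate solution of D(c',k'): w₀ ∈ ℚ and (w₁,…,w_{d'}) given as a
-- function ℕ → ℚ (only the values at 1,…,d' are ever used).
Sol : Set
Sol = ℚ × (ℕ → ℚ)

module _ (Δ : ℕ) where

  lowIdx : ℕ → ℕ
  lowIdx i = 1 ⊔ (suc i ∸ Δ)

  lhs : Sol → ℕ → ℚ
  lhs (w₀ , w) i = w₀ ℚ.+ rangeSum w (lowIdx i) i

  Feasible : ∀ {d'} → Vec ℕ d' → Sol → Set
  Feasible {d'} c (w₀ , w) =
    (∀ i → 1 ℕ.≤ i → i ℕ.≤ d' → ℕ→ℚ (entry c i) ℚ.≤ lhs (w₀ , w) i) ×
    (∀ i → 1 ℕ.≤ i → i ℕ.≤ d' → 0ℚ ℚ.≤ w i)

  objective : (d' k' : ℕ) → Sol → ℚ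
  objective d' k' (w₀ , w) = w₀ ℚ.* ℕ→ℚ k' ℚ.+ rangeSum w 1 d'

  Optimal : ∀ {d'} → Vec ℕ d' → ℕ → Sol → Set
  Optimal {d'} c k' w =
    Feasible c w × (∀ u → Feasible c u → objective d' k' w ℚ.≤ objective d' k' u)

  -- Dual-Greedy.  greedyRev c v i = [w_i, w_{i-1}, …, w_1]; hence
  -- take (Δ ∸ 1) of it is exactly [w_{i-1}, …, w_{max{1,i-Δ+1}}] when
  -- computing w_{i}.
  greedyRev : ∀ {d'} → Vec ℕ d' → ℚ → ℕ → List ℚ
  greedyRev c v zero    = []
  greedyRev c v (suc i) =
    let prev = greedyRev c v i in
    (0ℚ ℚ.⊔ (ℕ→ℚ (entry c (suc i)) ℚ.- (v ℚ.+ sumℚ (take (Δ ∸ 1) prev)))) ∷ prev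

  headOr0 : List ℚ → ℚ
  headOr0 []      = 0ℚ
  headOr0 (x ∷ _) = x

  dualGreedy : ∀ {d'} → Vec ℕ d' → ℤ → Sol
  dualGreedy c v = ℤ→ℚ v , (λ i → headOr0 (greedyRev c (ℤ→ℚ v) i))

  -- State: last ∈ {-∞} ∪ ℕ (nothing = -∞),
  -- and the list of active indices produced so far (in reverse).
  -- test "last ≤ i - Δ" (always true for last = -∞); for last = ℓ this is ℓ + Δ ≤ i
  lastOK : Maybe ℕ → ℕ → Bool
  lastOK nothing  i = true
  lastOK (just ℓ) i = does (ℓ ℕ.+ Δ ℕ.≤? i)

  activeStep : ∀ {d'} → Vec ℕ d' → Sol → Maybe ℕ × List ℕ → ℕ → Maybe ℕ × List ℕ
  activeStep c w (last , act) i =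
    if lastOK last i ∧ does (ℕ→ℚ (entry c i) ℚP.≟ lhs w i)
    then (just i , i ∷ act)
    else (last , act)

  activeConstraints : ∀ {d'} → Vec ℕ d' → Sol → List ℕ
  activeConstraints {d'} c w = L.reverse (proj₂ (foldl (activeStep c w) (nothing , []) (range 1 d')))

module Submission where

-- Write w(x) = Dual-Greedy(c', x) and total x i = w₁ + ⋯ + wᵢ.  The greedy recurrence reads
-- total x (n+1) = max (total x n) (c'ₙ₊₁ - x + total x (n+1-Δ)), and constraint n+1 is tight
-- exactly when the second argument wins.  Hence (i) the greedy totals are pointwise minimal
-- among feasible solutions with the same w₀, so w(x) is optimal iff x minimises the convex
-- function y ↦ y·k' + total y d'; and (ii) scanning the tight constraints as Active-Constraints
-- does, the count m(x, i) of active indices in 1..i satisfies m(n+1) = 1 + m(n+1-Δ) at tight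
-- and m(n+1) = m(n) at slack constraints.  By induction on i, m(x, i) is a supporting slope:
-- total x i + m(x,i)·(x - y) ≤ total y i for all y, and for integral x lowering w₀ by one
-- raises total by at most m(x, i).  So m(x, d') and m(x+1, d') are the one-sided slopes of
-- y ↦ total y d' at x, and x is a minimiser of y·k' + total y d' iff they bracket k'.

module DualGreedy where

  open import Defs
  open import Data.Nat as ℕ using (ℕ; zero; suc; _∸_; z≤n; s≤s)
  import Data.Nat.Properties as ℕP
  open import Data.Integer as ℤ using (ℤ)
  import Data.Integer.Properties as ℤP
  import Data.Nat.Coprimality as Coprime
  open import Data.Rational using (ℚ; 0ℚ; 1ℚ; mkℚ; _+_; _-_; -_; _*_; _≤_; _<_; _⊔_; *≤*; *<*; nonNegative)
  open import Data.Rational.Properties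
  open import Data.List as List using (List; []; _∷_; _++_; map; upTo; take; drop; length)
  import Data.List.Properties as ListP
  open import Data.Vec using (Vec)
  open import Data.Nat.Induction using (<-rec)
  open import Relation.Nullary using (¬_; yes; no)
  open import Data.Empty using (⊥-elim)
  open import Data.Unit using (⊤; tt)
  open import Data.Bool using (true; false)
  open import Relation.Nullary.Reflects using (ofʸ; ofⁿ)
  open import Data.Maybe using (Maybe; just; nothing)
  open import Function.Bundles using (_⇔_; mk⇔)
  open import Data.Product using (_×_; _,_; proj₁; proj₂; Σ)
  open import Data.Sum using (inj₁; inj₂)
  open import Relation.Binary.PropositionalEquality
  open import Function using (_∘_)
  open import Data.Rational.Solver using (module +-*-Solver)
  open +-*-Solver

  add-sub-cancel : ∀ z r → z + r - r ≡ z
  add-sub-cancel = solve 2 (λ z r → z :+ r :- r := z) refl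

  shift-support : ∀ p A x y → p + A + A * (x - y) ≡ p + A * (x + 1ℚ - y)
  shift-support = solve 4 (λ p A x y → p :+ A :+ A :* (x :- y) := p :+ A :* (x :+ con 1ℚ :- y)) refl

  move-value : ∀ x K p A y → x * K + p + (A - K) * (x - y) ≡ y * K + (p + A * (x - y))
  move-value = solve 5 (λ x K p A y → x :* K :+ p :+ (A :- K) :* (x :- y) := y :* K :+ (p :+ A :* (x :- y))) refl

  flip-factors : ∀ A K x y → (K - A) * (y - x) ≡ (A - K) * (x - y)
  flip-factors = solve 4 (λ A K x y → (K :- A) :* (y :- x) := (A :- K) :* (x :- y)) refl

  next-value : ∀ x K q → (x + 1ℚ) * K + q ≡ K + (x * K + q)
  next-value = solve 3 (λ x K q → (x :+ con 1ℚ) :* K :+ q := K :+ (x :* K :+ q)) refl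

  previous-value : ∀ x K p → K + ((x - 1ℚ) * K + p) ≡ x * K + p
  previous-value = solve 3 (λ x K p → K :+ ((x :- con 1ℚ) :* K :+ p) := x :* K :+ p) refl

  bring-forward : ∀ A x K q → A + (x * K + q) ≡ x * K + (q + A)
  bring-forward = solve 4 (λ A x K q → A :+ (x :* K :+ q) := x :* K :+ (q :+ A)) refl

  unit-gap : ∀ x → x + 1ℚ - x ≡ 1ℚ
  unit-gap = solve 1 (λ x → x :+ con 1ℚ :- x := con 1ℚ) refl

  unit-back : ∀ x → x + 1ℚ - 1ℚ ≡ x
  unit-back = solve 1 (λ x → x :+ con 1ℚ :- con 1ℚ := x) refl

  absorb-window : ∀ a x r t → a - (x + r) + (r + t) ≡ a - x + t
  absorb-window = solve 4 (λ a x r t → a :- (x :+ r) :+ (r :+ t) := a :- x :+ t) refl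

  split-lhs : ∀ x r t a → x + r ≡ ((t + r) - (a - x + t)) + a
  split-lhs = solve 4 (λ x r t a → x :+ r := ((t :+ r) :- (a :- x :+ t)) :+ a) refl

  split-prefix : ∀ a u r p s → s + r ≡ (a - u + p) + ((s - p) + ((u + r) - a))
  split-prefix = solve 5 (λ a u r p s → s :+ r := (a :- u :+ p) :+ ((s :- p) :+ ((u :+ r) :- a))) refl

  recover-left : ∀ t r a → t ≡ ((t - r) + a) - a + r
  recover-left = solve 3 (λ t r a → t := ((t :- r) :+ a) :- a :+ r) refl

  cancel-left : ∀ a r → a - a + r ≡ r
  cancel-left = solve 2 (λ a r → a :- a :+ r := r) refl

  shift-requirement : ∀ a x y t k → a - x + t + (k + 1ℚ) * (x - y) ≡ a - y + (t + k * (x - y))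
  shift-requirement = solve 5 (λ a x y t k → a :- x :+ t :+ (k :+ con 1ℚ) :* (x :- y) := a :- y :+ (t :+ k :* (x :- y))) refl

  lower-requirement : ∀ a x t k → a - (x - 1ℚ) + (t + k) ≡ (a - x + t + 1ℚ) + k
  lower-requirement = solve 4 (λ a x t k → a :- (x :- con 1ℚ) :+ (t :+ k) := (a :- x :+ t :+ con 1ℚ) :+ k) refl

  ≤-by-gap : ∀ {a b} e → 0ℚ ≤ e → b ≡ a + e → a ≤ b
  ≤-by-gap {a} e 0≤e refl = subst (_≤ a + e) (+-identityʳ a) (+-monoʳ-≤ a 0≤e)

  gap-nonneg : ∀ {a b} → a ≤ b → 0ℚ ≤ b - a
  gap-nonneg {a} {b} a≤b = subst (_≤ b - a) (+-inverseʳ a) (+-monoˡ-≤ (- a) a≤b)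

  nonneg-* : ∀ {p q} → 0ℚ ≤ p → 0ℚ ≤ q → 0ℚ ≤ p * q
  nonneg-* {p} {q} 0≤p 0≤q = subst (_≤ p * q) (*-zeroʳ p) (*-monoˡ-≤-nonNeg p {{nonNegative 0≤p}} 0≤q)

  +-cancelʳ-≤ : ∀ {p q} r → p + r ≤ q + r → p ≤ q
  +-cancelʳ-≤ {p} {q} r h = subst₂ _≤_ (add-sub-cancel p r) (add-sub-cancel q r) (+-monoˡ-≤ (- r) h)

  -- ℤ→ℚ z = z / 1 is the rational with numerator z and denominator 1; through this form
  -- ℤ→ℚ is an additive, order-preserving and order-reflecting embedding
  whole : ℤ → ℚ
  whole z = mkℚ z 0 (Coprime.sym (Coprime.1-coprimeTo _))

  ℤ→ℚ-whole : ∀ z → ℤ→ℚ z ≡ whole z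
  ℤ→ℚ-whole z = ↥p/↧p≡p (whole z)

  ℤ→ℚ-+ : ∀ a b → ℤ→ℚ a + ℤ→ℚ b ≡ ℤ→ℚ (a ℤ.+ b)
  ℤ→ℚ-+ a b rewrite ℤ→ℚ-whole a | ℤ→ℚ-whole b =
    cong ℤ→ℚ (cong₂ ℤ._+_ (ℤP.*-identityʳ a) (ℤP.*-identityʳ b))

  ℤ→ℚ-neg : ∀ a → - ℤ→ℚ a ≡ ℤ→ℚ (ℤ.- a)
  ℤ→ℚ-neg a rewrite ℤ→ℚ-whole a | ℤ→ℚ-whole (ℤ.- a) = negate a
    where
    negate : ∀ a → - whole a ≡ whole (ℤ.- a)
    negate (ℤ.+ zero) = refl
    negate ℤ.+[1+ n ] = refl
    negate ℤ.-[1+ n ] = refl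

  ℤ→ℚ-mono-≤ : ∀ {a b} → a ℤ.≤ b → ℤ→ℚ a ≤ ℤ→ℚ b
  ℤ→ℚ-mono-≤ {a} {b} a≤b rewrite ℤ→ℚ-whole a | ℤ→ℚ-whole b =
    *≤* (subst₂ ℤ._≤_ (sym (ℤP.*-identityʳ a)) (sym (ℤP.*-identityʳ b)) a≤b)

  ℤ→ℚ-cancel-≤ : ∀ {a b} → ℤ→ℚ a ≤ ℤ→ℚ b → a ℤ.≤ b
  ℤ→ℚ-cancel-≤ {a} {b} h rewrite ℤ→ℚ-whole a | ℤ→ℚ-whole b with h
  ... | *≤* a≤b = subst₂ ℤ._≤_ (ℤP.*-identityʳ a) (ℤP.*-identityʳ b) a≤b

  ℤ→ℚ-cancel-< : ∀ {a b} → ℤ→ℚ a < ℤ→ℚ b → a ℤ.< b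
  ℤ→ℚ-cancel-< {a} {b} h rewrite ℤ→ℚ-whole a | ℤ→ℚ-whole b with h
  ... | *<* a<b = subst₂ ℤ._<_ (ℤP.*-identityʳ a) (ℤP.*-identityʳ b) a<b

  IsInt : ℚ → Set
  IsInt q = Σ ℤ (λ z → q ≡ ℤ→ℚ z)

  int-+ : ∀ {p q} → IsInt p → IsInt q → IsInt (p + q)
  int-+ (a , refl) (b , refl) = a ℤ.+ b , ℤ→ℚ-+ a b

  int-- : ∀ {p q} → IsInt p → IsInt q → IsInt (p - q)
  int-- ip (b , refl) = int-+ ip (ℤ.- b , ℤ→ℚ-neg b)

  int-⊔ : ∀ {p q} → IsInt p → IsInt q → IsInt (p ⊔ q)
  int-⊔ {p} {q} ip iq with ⊔-sel p q
  ... | inj₁ p⊔q≡p = subst IsInt (sym p⊔q≡p) ip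
  ... | inj₂ p⊔q≡q = subst IsInt (sym p⊔q≡q) iq

  int-<⇒+1≤ : ∀ {p q} → IsInt p → IsInt q → p < q → p + 1ℚ ≤ q
  int-<⇒+1≤ (a , refl) (b , refl) a<b =
    subst (_≤ ℤ→ℚ b) (sym (ℤ→ℚ-+ a (ℤ.+ 1)))
      (ℤ→ℚ-mono-≤ (subst (ℤ._≤ b) (ℤP.+-comm (ℤ.+ 1) a) (ℤP.i<j⇒suc[i]≤j (ℤ→ℚ-cancel-< {a} {b} a<b))))

  ℕ→ℚ-mono-≤ : ∀ {a b} → a ℕ.≤ b → ℕ→ℚ a ≤ ℕ→ℚ b
  ℕ→ℚ-mono-≤ a≤b = ℤ→ℚ-mono-≤ (ℤ.+≤+ a≤b)

  ℕ→ℚ-cancel-≤ : ∀ {a b} → ℕ→ℚ a ≤ ℕ→ℚ b → a ℕ.≤ b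
  ℕ→ℚ-cancel-≤ h = ℤP.drop‿+≤+ (ℤ→ℚ-cancel-≤ h)

  ℕ→ℚ-suc : ∀ k → ℕ→ℚ (suc k) ≡ ℕ→ℚ k + 1ℚ
  ℕ→ℚ-suc k = trans (cong (λ t → ℤ→ℚ (ℤ.+ t)) (ℕP.+-comm 1 k)) (sym (ℤ→ℚ-+ (ℤ.+ k) (ℤ.+ 1)))

  Supports : (ℚ → ℚ) → ℚ → ℚ → Set
  Supports φ x A = ∀ y → φ x + A * (x - y) ≤ φ y

  support-shift : ∀ (φ : ℚ → ℚ) x A → Supports φ (x + 1ℚ) A → φ x ≤ φ (x + 1ℚ) + A → Supports φ x A
  support-shift φ x A support drop y = begin
      φ x + A * (x - y)
    ≤⟨ +-monoˡ-≤ (A * (x - y)) drop ⟩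
      φ (x + 1ℚ) + A + A * (x - y)
    ≡⟨ shift-support (φ (x + 1ℚ)) A x y ⟩
      φ (x + 1ℚ) + A * (x + 1ℚ - y)
    ≤⟨ support y ⟩
      φ y
    ∎
    where open ≤-Reasoning

  value-gap : ∀ (φ : ℚ → ℚ) K x A → Supports φ x A → ∀ y → x * K + φ x + (A - K) * (x - y) ≤ y * K + φ y
  value-gap φ K x A support y = begin
      x * K + φ x + (A - K) * (x - y)
    ≡⟨ move-value x K (φ x) A y ⟩
      y * K + (φ x + A * (x - y))
    ≤⟨ +-monoʳ-≤ (y * K) (support y) ⟩
      y * K + φ y
    ∎
    where open ≤-Reasoning

  bracketed⇒minimal : ∀ (φ : ℚ → ℚ) K x A₁ A₂ → Supports φ x A₁ → Supports φ x A₂ → A₂ ≤ K → K ≤ A₁ →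
                      ∀ y → x * K + φ x ≤ y * K + φ y
  bracketed⇒minimal φ K x A₁ A₂ support₁ support₂ A₂≤K K≤A₁ y with ≤-total y x
  ... | inj₁ y≤x = ≤-trans (≤-by-gap _ (nonneg-* (gap-nonneg K≤A₁) (gap-nonneg y≤x)) refl)
                           (value-gap φ K x A₁ support₁ y)
  ... | inj₂ x≤y = ≤-trans (≤-by-gap _ gap≥0 refl) (value-gap φ K x A₂ support₂ y)
    where
    gap≥0 : 0ℚ ≤ (A₂ - K) * (x - y)
    gap≥0 = subst (0ℚ ≤_) (flip-factors A₂ K x y)
                  (nonneg-* (gap-nonneg A₂≤K) (gap-nonneg x≤y))

  drop≤K-at-minimum : ∀ (φ : ℚ → ℚ) (K x A : ℚ) → x * K + φ x ≤ (x + 1ℚ) * K + φ (x + 1ℚ) → φ (x + 1ℚ) + A ≤ φ x → A ≤ K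
  drop≤K-at-minimum φ K x A minimal drop = +-cancelʳ-≤ (x * K + φ (x + 1ℚ)) (begin
      A + (x * K + φ (x + 1ℚ))
    ≡⟨ bring-forward A x K (φ (x + 1ℚ)) ⟩
      x * K + (φ (x + 1ℚ) + A)
    ≤⟨ +-monoʳ-≤ (x * K) drop ⟩
      x * K + φ x
    ≤⟨ minimal ⟩
      (x + 1ℚ) * K + φ (x + 1ℚ)
    ≡⟨ next-value x K (φ (x + 1ℚ)) ⟩
      K + (x * K + φ (x + 1ℚ))
    ∎)
    where open ≤-Reasoning

  K≤rise-at-minimum : ∀ (φ : ℚ → ℚ) (K x A : ℚ) → x * K + φ x ≤ (x - 1ℚ) * K + φ (x - 1ℚ) → φ (x - 1ℚ) ≤ φ x + A → K ≤ A
  K≤rise-at-minimum φ K x A minimal rise = +-cancelʳ-≤ ((x - 1ℚ) * K + φ x) (begin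
      K + ((x - 1ℚ) * K + φ x)
    ≡⟨ previous-value x K (φ x) ⟩
      x * K + φ x
    ≤⟨ minimal ⟩
      (x - 1ℚ) * K + φ (x - 1ℚ)
    ≤⟨ +-monoʳ-≤ ((x - 1ℚ) * K) rise ⟩
      (x - 1ℚ) * K + (φ x + A)
    ≡⟨ sym (bring-forward A (x - 1ℚ) K (φ x)) ⟩
      A + ((x - 1ℚ) * K + φ x)
    ∎)
    where open ≤-Reasoning

  sumℚ-++ : ∀ xs ys → sumℚ (xs ++ ys) ≡ sumℚ xs + sumℚ ys
  sumℚ-++ []       ys = sym (+-identityˡ _)
  sumℚ-++ (x ∷ xs) ys = trans (cong (x +_) (sumℚ-++ xs ys)) (sym (+-assoc x _ _))

  sumℚ-take-drop : ∀ k xs → sumℚ (take k xs) + sumℚ (drop k xs) ≡ sumℚ xs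
  sumℚ-take-drop zero    xs       = +-identityˡ _
  sumℚ-take-drop (suc k) []       = +-identityˡ _
  sumℚ-take-drop (suc k) (x ∷ xs) = trans (+-assoc x _ _) (cong (x +_) (sumℚ-take-drop k xs))

  blockSum : (ℕ → ℚ) → ℕ → ℕ → ℚ
  blockSum f lo zero    = 0ℚ
  blockSum f lo (suc n) = blockSum f lo n + f (lo ℕ.+ n)

  rangeSum-blockSum : ∀ f lo hi → rangeSum f lo hi ≡ blockSum f lo (suc hi ∸ lo)
  rangeSum-blockSum f lo hi = go (suc hi ∸ lo)
    where
    go : ∀ n → sumℚ (map f (map (lo ℕ.+_) (upTo n))) ≡ blockSum f lo n
    go zero    = refl
    go (suc n) = begin
        sumℚ (map f (map (lo ℕ.+_) (upTo (suc n))))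
      ≡⟨ cong (λ l → sumℚ (map f (map (lo ℕ.+_) l))) (sym (ListP.upTo-∷ʳ n)) ⟩
        sumℚ (map f (map (lo ℕ.+_) (upTo n ++ n ∷ [])))
      ≡⟨ cong sumℚ (trans (cong (map f) (ListP.map-++ (lo ℕ.+_) (upTo n) (n ∷ [])))
                          (ListP.map-++ f (map (lo ℕ.+_) (upTo n)) (lo ℕ.+ n ∷ []))) ⟩
        sumℚ (map f (map (lo ℕ.+_) (upTo n)) ++ f (lo ℕ.+ n) ∷ [])
      ≡⟨ sumℚ-++ (map f (map (lo ℕ.+_) (upTo n))) _ ⟩
        sumℚ (map f (map (lo ℕ.+_) (upTo n))) + (f (lo ℕ.+ n) + 0ℚ)
      ≡⟨ cong₂ _+_ (go n) (+-identityʳ _) ⟩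
        blockSum f lo (suc n)
      ∎
      where open ≡-Reasoning

  blockSum-split : ∀ f lo m n → blockSum f lo (m ℕ.+ n) ≡ blockSum f lo m + blockSum f (lo ℕ.+ m) n
  blockSum-split f lo m zero    = trans (cong (blockSum f lo) (ℕP.+-identityʳ m)) (sym (+-identityʳ _))
  blockSum-split f lo m (suc n) = begin
      blockSum f lo (m ℕ.+ suc n)
    ≡⟨ cong (blockSum f lo) (ℕP.+-suc m n) ⟩
      blockSum f lo (m ℕ.+ n) + f (lo ℕ.+ (m ℕ.+ n))
    ≡⟨ cong₂ _+_ (blockSum-split f lo m n) (cong f (sym (ℕP.+-assoc lo m n))) ⟩
      (blockSum f lo m + blockSum f (lo ℕ.+ m) n) + f (lo ℕ.+ m ℕ.+ n)
    ≡⟨ +-assoc (blockSum f lo m) _ _ ⟩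
      blockSum f lo m + blockSum f (lo ℕ.+ m) (suc n)
    ∎
    where open ≡-Reasoning

  prefix : (ℕ → ℚ) → ℕ → ℚ
  prefix f n = rangeSum f 1 n

  prefix-suc : ∀ f n → prefix f (suc n) ≡ prefix f n + f (suc n)
  prefix-suc f n = trans (rangeSum-blockSum f 1 (suc n)) (cong (_+ f (suc n)) (sym (rangeSum-blockSum f 1 n)))

  lowIdx-suc : ∀ δ n → lowIdx (suc δ) (suc n) ≡ suc (n ∸ δ)
  lowIdx-suc zero    n       = refl
  lowIdx-suc (suc δ) zero    = cong (1 ℕ.⊔_) (ℕP.0∸n≡0 δ)
  lowIdx-suc (suc δ) (suc n) = lowIdx-suc δ n

  window-split : ∀ δ f n → prefix f (n ∸ δ) + rangeSum f (lowIdx (suc δ) (suc n)) (suc n) ≡ prefix f (suc n)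
  window-split δ f n = begin
      prefix f j + rangeSum f (lowIdx (suc δ) (suc n)) (suc n)
    ≡⟨ cong (λ lo → prefix f j + rangeSum f lo (suc n)) (lowIdx-suc δ n) ⟩
      prefix f j + rangeSum f (suc j) (suc n)
    ≡⟨ cong₂ _+_ (rangeSum-blockSum f 1 j) (rangeSum-blockSum f (suc j) (suc n)) ⟩
      blockSum f 1 j + blockSum f (suc j) (suc n ∸ j)
    ≡⟨ sym (blockSum-split f 1 j (suc n ∸ j)) ⟩
      blockSum f 1 (j ℕ.+ (suc n ∸ j))
    ≡⟨ cong (blockSum f 1) (ℕP.m+[n∸m]≡n (ℕP.≤-trans (ℕP.m∸n≤m n δ) (ℕP.n≤1+n n))) ⟩
      blockSum f 1 (suc n)
    ≡⟨ sym (rangeSum-blockSum f 1 (suc n)) ⟩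
      prefix f (suc n)
    ∎
    where
    open ≡-Reasoning
    j : ℕ
    j = n ∸ δ

  module Greedy (δ : ℕ) {d : ℕ} (c : Vec ℕ d) where

    Δ : ℕ
    Δ = suc δ

    demand : ℕ → ℚ
    demand i = ℕ→ℚ (entry c i)

    history : ℚ → ℕ → List ℚ
    history x i = greedyRev Δ c x i

    weight : ℚ → ℕ → ℚ
    weight x i = headOr0 Δ (history x i)

    greedy : ℚ → Sol
    greedy x = x , weight x

    total : ℚ → ℕ → ℚ
    total x i = sumℚ (history x i)

    -- the least value of total x (n+1) for which constraint n+1 holds
    required : ℚ → ℕ → ℚ
    required x n = demand (suc n) - x + total x (n ∸ δ)

    total-prefix : ∀ x n → prefix (weight x) n ≡ total x n
    total-prefix x zero    = refl
    total-prefix x (suc n) = trans (prefix-suc (weight x) n)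
      (trans (cong (_+ weight x (suc n)) (total-prefix x n)) (+-comm (total x n) (weight x (suc n))))

    recent-split : ∀ x n → sumℚ (take δ (history x n)) + total x (n ∸ δ) ≡ total x n
    recent-split x n = trans (cong (λ l → sumℚ (take δ (history x n)) + sumℚ l) (sym (drop-history δ n)))
                             (sumℚ-take-drop δ (history x n))
      where
      drop-history : ∀ k n → drop k (history x n) ≡ history x (n ∸ k)
      drop-history zero    n       = refl
      drop-history (suc k) zero    = refl
      drop-history (suc k) (suc n) = drop-history k n

    total-suc : ∀ x n → total x (suc n) ≡ total x n ⊔ required x n
    total-suc x n = begin
        (0ℚ ⊔ (demand (suc n) - (x + r))) + total x n
      ≡⟨ mono-≤-distrib-⊔ (+-monoˡ-≤ (total x n)) 0ℚ (demand (suc n) - (x + r)) ⟩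
        (0ℚ + total x n) ⊔ ((demand (suc n) - (x + r)) + total x n)
      ≡⟨ cong₂ _⊔_ (+-identityˡ (total x n)) (cong (demand (suc n) - (x + r) +_) (sym (recent-split x n))) ⟩
        total x n ⊔ ((demand (suc n) - (x + r)) + (r + t))
      ≡⟨ cong (total x n ⊔_) (absorb-window (demand (suc n)) x r t) ⟩
        total x n ⊔ required x n
      ∎
      where
      open ≡-Reasoning
      r t : ℚ
      r = sumℚ (take δ (history x n))
      t = total x (n ∸ δ)

    total-mono-suc : ∀ x n → total x n ≤ total x (suc n)
    total-mono-suc x n = subst (total x n ≤_) (sym (total-suc x n)) (p≤p⊔q (total x n) (required x n))

    required≤total : ∀ x n → required x n ≤ total x (suc n)
    required≤total x n = subst (required x n ≤_) (sym (total-suc x n)) (p≤q⊔p (total x n) (required x n))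

    lhs-greedy : ∀ x n → lhs Δ (greedy x) (suc n) ≡ (total x (suc n) - required x n) + demand (suc n)
    lhs-greedy x n = begin
        x + r
      ≡⟨ split-lhs x r t (demand (suc n)) ⟩
        ((t + r) - required x n) + demand (suc n)
      ≡⟨ cong (λ p → (p - required x n) + demand (suc n)) window ⟩
        (total x (suc n) - required x n) + demand (suc n)
      ∎
      where
      open ≡-Reasoning
      r t : ℚ
      r = rangeSum (weight x) (lowIdx Δ (suc n)) (suc n)
      t = total x (n ∸ δ)
      window : t + r ≡ total x (suc n)
      window = trans (cong (_+ r) (sym (total-prefix x (n ∸ δ))))
                     (trans (window-split δ (weight x) n) (total-prefix x (suc n)))

    greedy-feasible : ∀ x → Feasible Δ c (greedy x)
    greedy-feasible x = covered , nonneg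
      where
      covered : ∀ i → 1 ℕ.≤ i → i ℕ.≤ d → demand i ≤ lhs Δ (greedy x) i
      covered (suc n) _ _ = ≤-by-gap (total x (suc n) - required x n) (gap-nonneg (required≤total x n))
                              (trans (lhs-greedy x n) (+-comm _ (demand (suc n))))
      nonneg : ∀ i → 1 ℕ.≤ i → i ℕ.≤ d → 0ℚ ≤ weight x i
      nonneg (suc n) _ _ = p≤p⊔q 0ℚ (demand (suc n) - (x + sumℚ (take δ (history x n))))

    -- any feasible solution with the same w₀ has prefix sums at least the greedy totals:
    -- by strong induction, since constraint n+1 forces prefix u (n+1) ≥ c'ₙ₊₁ - u₀ + prefix u (n-δ)
    total-minimal : ∀ u₀ u → Feasible Δ c (u₀ , u) → ∀ i → i ℕ.≤ d → total u₀ i ≤ prefix u i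
    total-minimal u₀ u (covered , nonneg) = <-rec (λ i → i ℕ.≤ d → total u₀ i ≤ prefix u i) go
      where
      go : ∀ i → (∀ {j} → j ℕ.< i → j ℕ.≤ d → total u₀ j ≤ prefix u j) →
             i ℕ.≤ d → total u₀ i ≤ prefix u i
      go zero    _  _   = ≤-refl
      go (suc n) IH n<d = subst (_≤ prefix u (suc n)) (sym (total-suc u₀ n)) (⊔-lub old new)
        where
        n≤d : n ℕ.≤ d
        n≤d = ℕP.<⇒≤ n<d
        j : ℕ
        j = n ∸ δ
        j≤n : j ℕ.≤ n
        j≤n = ℕP.m∸n≤m n δ
        a r : ℚ
        a = demand (suc n)
        r = rangeSum u (lowIdx Δ (suc n)) (suc n)
        old : total u₀ n ≤ prefix u (suc n)
        old = ≤-trans (IH (ℕP.n<1+n n) n≤d)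
                      (≤-by-gap (u (suc n)) (nonneg (suc n) (s≤s z≤n) n<d) (prefix-suc u n))
        new : required u₀ n ≤ prefix u (suc n)
        new = ≤-by-gap ((prefix u j - total u₀ j) + ((u₀ + r) - a))
                (+-mono-≤ (gap-nonneg (IH (s≤s j≤n) (ℕP.≤-trans j≤n n≤d)))
                           (gap-nonneg (covered (suc n) (s≤s z≤n) n<d)))
                (trans (sym (window-split δ u n))
                  (split-prefix a u₀ r (total u₀ j) (prefix u j)))

    Tight : ℚ → ℕ → Set
    Tight x n = demand (suc n) ≡ lhs Δ (greedy x) (suc n)

    tight⇒total≡required : ∀ x n → Tight x n → total x (suc n) ≡ required x n
    tight⇒total≡required x n tight = begin
        t
      ≡⟨ recover-left t r a ⟩
        ((t - r) + a) - a + r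
      ≡⟨ cong (λ q → q - a + r) (trans (sym (lhs-greedy x n)) (sym tight)) ⟩
        a - a + r
      ≡⟨ cancel-left a r ⟩
        r
      ∎
      where
      open ≡-Reasoning
      t r a : ℚ
      t = total x (suc n)
      r = required x n
      a = demand (suc n)

    total≡required⇒tight : ∀ x n → total x (suc n) ≡ required x n → Tight x n
    total≡required⇒tight x n t≡r = sym (begin
        lhs Δ (greedy x) (suc n)
      ≡⟨ lhs-greedy x n ⟩
        (total x (suc n) - required x n) + demand (suc n)
      ≡⟨ cong (λ q → (q - required x n) + demand (suc n)) t≡r ⟩
        (required x n - required x n) + demand (suc n)
      ≡⟨ cong (_+ demand (suc n)) (+-inverseʳ (required x n))  ⟩
        0ℚ + demand (suc n)
      ≡⟨ +-identityˡ (demand (suc n)) ⟩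
        demand (suc n)
      ∎)
      where open ≡-Reasoning

    slack⇒required<total : ∀ x n → ¬ Tight x n → required x n < total x (suc n)
    slack⇒required<total x n slack =
      ≰⇒> (λ t≤r → slack (total≡required⇒tight x n (≤-antisym t≤r (required≤total x n))))

    slack⇒total-stays : ∀ x n → ¬ Tight x n → total x (suc n) ≡ total x n
    slack⇒total-stays x n slack with ⊔-sel (total x n) (required x n)
    ... | inj₁ ⊔≡old = trans (total-suc x n) ⊔≡old
    ... | inj₂ ⊔≡new = ⊥-elim (slack (total≡required⇒tight x n (trans (total-suc x n) ⊔≡new)))

    State : Set
    State = Maybe ℕ × List ℕ

    scan : ℚ → ℕ → State
    scan x zero    = nothing , []
    scan x (suc n) = activeStep Δ c (greedy x) (scan x n) (suc n)

    count : ℚ → ℕ → ℕ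
    count x n = length (proj₂ (scan x n))

    activeConstraints-count : ∀ x → length (activeConstraints Δ c (greedy x)) ≡ count x d
    activeConstraints-count x =
      trans (ListP.length-reverse (proj₂ (List.foldl visit (nothing , []) (range 1 d))))
            (cong (λ s → length (proj₂ s)) (foldl-scan d))
      where
      visit : State → ℕ → State
      visit = activeStep Δ c (greedy x)
      range-suc : ∀ n → range 1 (suc n) ≡ range 1 n ++ suc n ∷ []
      range-suc n = trans (cong (map (1 ℕ.+_)) (sym (ListP.upTo-∷ʳ n))) (ListP.map-++ (1 ℕ.+_) (upTo n) (n ∷ []))
      foldl-scan : ∀ n → List.foldl visit (nothing , []) (range 1 n) ≡ scan x n
      foldl-scan zero    = refl
      foldl-scan (suc n) = begin
          List.foldl visit (nothing , []) (range 1 (suc n))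
        ≡⟨ cong (List.foldl visit (nothing , [])) (range-suc n) ⟩
          List.foldl visit (nothing , []) (range 1 n ++ suc n ∷ [])
        ≡⟨ ListP.foldl-++ visit (nothing , []) (range 1 n) (suc n ∷ []) ⟩
          visit (List.foldl visit (nothing , []) (range 1 n)) (suc n)
        ≡⟨ cong (λ s → visit s (suc n)) (foldl-scan n) ⟩
          scan x (suc n)
        ∎
        where open ≡-Reasoning

    Spaced : Maybe ℕ → ℕ → Set
    Spaced nothing  i = ⊤
    Spaced (just ℓ) i = ℓ ℕ.+ Δ ℕ.≤ i

    data Outcome (x : ℚ) (n : ℕ) (s : State) : State → Set where
      added   : Tight x n → Spaced (proj₁ s) (suc n) → Outcome x n s (just (suc n) , suc n ∷ proj₂ s)
      blocked : Tight x n → ¬ Spaced (proj₁ s) (suc n) → Outcome x n s s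
      slack   : ¬ Tight x n → Outcome x n s s

    outcome : ∀ x n s → Outcome x n s (activeStep Δ c (greedy x) s (suc n))
    outcome x n (nothing , act) with ℕ→ℚ (entry c (suc n)) ≟ lhs Δ (greedy x) (suc n)
    ... | yes tight = added tight tt
    ... | no ¬tight = slack ¬tight
    outcome x n (just ℓ , act)
      with ℓ ℕ.+ Δ ℕ.≤ᵇ suc n | ℕP.≤ᵇ-reflects-≤ (ℓ ℕ.+ Δ) (suc n)
         | ℕ→ℚ (entry c (suc n)) ≟ lhs Δ (greedy x) (suc n)
    ... | true  | ofʸ spaced  | yes tight = added tight spaced
    ... | false | ofⁿ ¬spaced | yes tight = blocked tight ¬spaced
    ... | true  | _           | no ¬tight = slack ¬tight
    ... | false | _           | no ¬tight = slack ¬tight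

    count-mono-suc : ∀ x n → count x n ℕ.≤ count x (suc n)
    count-mono-suc x n = grows (outcome x n (scan x n)) refl
      where
      grows : ∀ {s'} → Outcome x n (scan x n) s' → scan x (suc n) ≡ s' → count x n ℕ.≤ count x (suc n)
      grows (added _ _)   e = subst (count x n ℕ.≤_) (sym (cong (length ∘ proj₂) e)) (ℕP.n≤1+n _)
      grows (blocked _ _) e = ℕP.≤-reflexive (sym (cong (length ∘ proj₂) e))
      grows (slack _)     e = ℕP.≤-reflexive (sym (cong (length ∘ proj₂) e))

    count-mono : ∀ x {a b} → a ℕ.≤ b → count x a ℕ.≤ count x b
    count-mono x {b = zero}  z≤n = ℕP.≤-refl
    count-mono x {b = suc b} a≤1+b with ℕP.m≤n⇒m<n∨m≡n a≤1+b
    ... | inj₁ (s≤s a≤b) = ℕP.≤-trans (count-mono x a≤b) (count-mono-suc x b)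
    ... | inj₂ refl      = ℕP.≤-refl

    -- what the memory `last` certifies after scanning 1..n: the last added index is p+1,
    -- nothing was added after it, and nothing in the Δ-1 positions before it
    data LastActive (x : ℚ) (n : ℕ) : Maybe ℕ → Set where
      none : count x n ≡ 0 → LastActive x n nothing
      at   : ∀ {p} → p ℕ.< n → count x n ≡ count x (suc p) → count x (suc p) ≡ suc (count x p) →
             count x (p ∸ δ) ≡ count x p → LastActive x n (just (suc p))

    spaced⇒quiet : ∀ x n {last} → LastActive x n last → Spaced last (suc n) → count x (n ∸ δ) ≡ count x n
    spaced⇒quiet x n (none count≡0) _ =
      trans (ℕP.n≤0⇒n≡0 (subst (count x (n ∸ δ) ℕ.≤_) count≡0 (count-mono x (ℕP.m∸n≤m n δ)))) (sym count≡0)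
    spaced⇒quiet x n (at {p} _ n↦p+1 _ _) spaced =
      ℕP.≤-antisym (count-mono x (ℕP.m∸n≤m n δ))
                   (subst (ℕ._≤ count x (n ∸ δ)) (sym n↦p+1) (count-mono x p+1≤n-δ))
      where
      p+1≤n-δ : suc p ℕ.≤ n ∸ δ
      p+1≤n-δ = ℕP.m+n≤o⇒m≤o∸n (suc p) (subst (ℕ._≤ n) (ℕP.+-suc p δ) (ℕ.s≤s⁻¹ spaced))

    unspaced⇒busy : ∀ x n {last} → LastActive x n last → ¬ Spaced last (suc n) → count x n ≡ suc (count x (n ∸ δ))
    unspaced⇒busy x n (none _) ¬spaced = ⊥-elim (¬spaced tt)
    unspaced⇒busy x n (at {p} p<n n↦p+1 p+1↦p quiet) ¬spaced =
      trans n↦p+1 (trans p+1↦p (cong suc (sym (ℕP.≤-antisym upper lower))))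
      where
      n-δ≤p : n ∸ δ ℕ.≤ p
      n-δ≤p = ℕP.m≤n+o⇒m∸n≤o n δ (subst (n ℕ.≤_) (ℕP.+-comm p δ)
                (ℕ.s≤s⁻¹ (subst (suc n ℕ.≤_) (ℕP.+-suc p δ) (ℕ.s≤s⁻¹ (ℕP.≰⇒> ¬spaced)))))
      upper : count x (n ∸ δ) ℕ.≤ count x p
      upper = count-mono x n-δ≤p
      lower : count x p ℕ.≤ count x (n ∸ δ)
      lower = subst (ℕ._≤ count x (n ∸ δ)) quiet (count-mono x (ℕP.∸-monoˡ-≤ δ (ℕP.<⇒≤ p<n)))

    lastActive : ∀ x n → LastActive x n (proj₁ (scan x n))
    lastActive x zero    = none refl
    lastActive x (suc n) = advance (outcome x n (scan x n)) refl
      where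
      keep : ∀ {last} → LastActive x n last → count x (suc n) ≡ count x n → LastActive x (suc n) last
      keep (none count≡0)           stays = none (trans stays count≡0)
      keep (at p<n n↦p+1 p+1↦p quiet) stays = at (ℕP.m≤n⇒m≤1+n p<n) (trans stays n↦p+1) p+1↦p quiet
      advance : ∀ {s'} → Outcome x n (scan x n) s' → scan x (suc n) ≡ s' → LastActive x (suc n) (proj₁ s')
      advance (added _ spaced) e =
        at ℕP.≤-refl refl (cong (length ∘ proj₂) e) (spaced⇒quiet x n (lastActive x n) spaced)
      advance (blocked _ _) e = keep (lastActive x n) (cong (length ∘ proj₂) e)
      advance (slack _)     e = keep (lastActive x n) (cong (length ∘ proj₂) e)

    count-tight : ∀ x n → Tight x n → count x (suc n) ≡ suc (count x (n ∸ δ))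
    count-tight x n tight = go (outcome x n (scan x n)) refl
      where
      go : ∀ {s'} → Outcome x n (scan x n) s' → scan x (suc n) ≡ s' → count x (suc n) ≡ suc (count x (n ∸ δ))
      go (added _ spaced)    e = trans (cong (length ∘ proj₂) e) (cong suc (sym (spaced⇒quiet x n (lastActive x n) spaced)))
      go (blocked _ ¬spaced) e = trans (cong (length ∘ proj₂) e) (unspaced⇒busy x n (lastActive x n) ¬spaced)
      go (slack ¬tight)      _ = ⊥-elim (¬tight tight)

    count-slack : ∀ x n → ¬ Tight x n → count x (suc n) ≡ count x n
    count-slack x n ¬tight = go (outcome x n (scan x n)) refl
      where
      go : ∀ {s'} → Outcome x n (scan x n) s' → scan x (suc n) ≡ s' → count x (suc n) ≡ count x n
      go (added tight _) _ = ⊥-elim (¬tight tight)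
      go (blocked _ _)   e = cong (length ∘ proj₂) e
      go (slack _)       e = cong (length ∘ proj₂) e

    data Step (x : ℚ) (n : ℕ) : Set where
      tight-step : total x (suc n) ≡ required x n → count x (suc n) ≡ suc (count x (n ∸ δ)) → Step x n
      slack-step : total x (suc n) ≡ total x n → required x n < total x (suc n) →
                   count x (suc n) ≡ count x n → Step x n

    step : ∀ x n → Step x n
    step x n with ℕ→ℚ (entry c (suc n)) ≟ lhs Δ (greedy x) (suc n)
    ... | yes tight = tight-step (tight⇒total≡required x n tight) (count-tight x n tight)
    ... | no ¬tight = slack-step (slack⇒total-stays x n ¬tight) (slack⇒required<total x n ¬tight)
                                 (count-slack x n ¬tight)

    rate : ℚ → ℕ → ℚ
    rate x i = ℕ→ℚ (count x i)

    rate-mono : ∀ x {a b} → a ℕ.≤ b → rate x a ≤ rate x b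
    rate-mono x a≤b = ℕ→ℚ-mono-≤ (count-mono x a≤b)

    rate-tight : ∀ x n → count x (suc n) ≡ suc (count x (n ∸ δ)) → rate x (suc n) ≡ rate x (n ∸ δ) + 1ℚ
    rate-tight x n e = trans (cong ℕ→ℚ e) (ℕ→ℚ-suc (count x (n ∸ δ)))

    -- Moving w₀ from x to y changes each greedy total by at least -(x - y)·rate: the rate
    -- is a supporting slope of y ↦ total y i at x (i.e. total · i is convex in w₀).
    total-support : ∀ x y i → total x i + rate x i * (x - y) ≤ total y i
    total-support x y = <-rec (λ i → total x i + rate x i * (x - y) ≤ total y i) go
      where
      go : ∀ i → (∀ {j} → j ℕ.< i → total x j + rate x j * (x - y) ≤ total y j) →
           total x i + rate x i * (x - y) ≤ total y i
      go zero    _  = ≤-reflexive (trans (cong (0ℚ +_) (*-zeroˡ (x - y))) (+-identityˡ 0ℚ))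
      go (suc n) IH = by-step (step x n)
        where
        j : ℕ
        j = n ∸ δ
        by-step : Step x n → total x (suc n) + rate x (suc n) * (x - y) ≤ total y (suc n)
        by-step (tight-step t≡r count↑) = begin
            total x (suc n) + rate x (suc n) * (x - y)
          ≡⟨ cong₂ (λ t k → t + k * (x - y)) t≡r (rate-tight x n count↑) ⟩
            required x n + (rate x j + 1ℚ) * (x - y)
          ≡⟨ shift-requirement (demand (suc n)) x y (total x j) (rate x j) ⟩
            demand (suc n) - y + (total x j + rate x j * (x - y))
          ≤⟨ +-monoʳ-≤ (demand (suc n) - y) (IH (s≤s (ℕP.m∸n≤m n δ))) ⟩
            required y n
          ≤⟨ required≤total y n ⟩
            total y (suc n)
          ∎
          where open ≤-Reasoning
        by-step (slack-step stays _ count=) = begin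
            total x (suc n) + rate x (suc n) * (x - y)
          ≡⟨ cong₂ (λ t k → t + ℕ→ℚ k * (x - y)) stays count= ⟩
            total x n + rate x n * (x - y)
          ≤⟨ IH (ℕP.n<1+n n) ⟩
            total y n
          ≤⟨ total-mono-suc y n ⟩
            total y (suc n)
          ∎
          where open ≤-Reasoning

    -- for integral w₀ all greedy totals are integral (the demands are natural numbers)
    total-int : ∀ x → IsInt x → ∀ i → IsInt (total x i)
    total-int x x-int = <-rec (λ i → IsInt (total x i)) go
      where
      go : ∀ i → (∀ {j} → j ℕ.< i → IsInt (total x j)) → IsInt (total x i)
      go zero    _  = ℤ.+ 0 , refl
      go (suc n) IH = subst IsInt (sym (total-suc x n))
        (int-⊔ (IH (ℕP.n<1+n n)) (int-+ (int-- (ℤ.+ entry c (suc n) , refl) x-int) (IH (s≤s (ℕP.m∸n≤m n δ)))))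

    required-int : ∀ x → IsInt x → ∀ n → IsInt (required x n)
    required-int x x-int n = int-+ (int-- (ℤ.+ entry c (suc n) , refl) x-int) (total-int x x-int (n ∸ δ))

    -- Lowering an integral w₀ by one unit raises each greedy total by at most the rate:
    -- the left derivative matching total-support.
    total-unit-step : ∀ x → IsInt x → ∀ i → total (x - 1ℚ) i ≤ total x i + rate x i
    total-unit-step x x-int = <-rec (λ i → total (x - 1ℚ) i ≤ total x i + rate x i) go
      where
      go : ∀ i → (∀ {j} → j ℕ.< i → total (x - 1ℚ) j ≤ total x j + rate x j) →
           total (x - 1ℚ) i ≤ total x i + rate x i
      go zero    _  = ≤-reflexive (sym (+-identityˡ 0ℚ))
      go (suc n) IH = subst (_≤ total x (suc n) + rate x (suc n)) (sym (total-suc (x - 1ℚ) n))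
                            (⊔-lub old new)
        where
        j : ℕ
        j = n ∸ δ
        old : total (x - 1ℚ) n ≤ total x (suc n) + rate x (suc n)
        old = ≤-trans (IH (ℕP.n<1+n n)) (+-mono-≤ (total-mono-suc x n) (rate-mono x (ℕP.n≤1+n n)))
        -- the new requirement exceeds the old one by one unit plus the change of total x j
        bump : (required x n + 1ℚ) + rate x j ≤ total x (suc n) + rate x (suc n)
        bump = by-step (step x n)
          where
          by-step : Step x n → (required x n + 1ℚ) + rate x j ≤ total x (suc n) + rate x (suc n)
          by-step (tight-step t≡r count↑) = ≤-reflexive (begin
              (required x n + 1ℚ) + rate x j
            ≡⟨ trans (+-assoc (required x n) 1ℚ (rate x j)) (cong (required x n +_) (+-comm 1ℚ (rate x j))) ⟩
              required x n + (rate x j + 1ℚ)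
            ≡⟨ cong₂ _+_ (sym t≡r) (sym (rate-tight x n count↑)) ⟩
              total x (suc n) + rate x (suc n)
            ∎)
            where open ≡-Reasoning
          by-step (slack-step _ r<t _) =
            +-mono-≤ (int-<⇒+1≤ (required-int x x-int n) (total-int x x-int (suc n)) r<t)
                     (rate-mono x (ℕP.≤-trans (ℕP.m∸n≤m n δ) (ℕP.n≤1+n n)))
        new : required (x - 1ℚ) n ≤ total x (suc n) + rate x (suc n)
        new = begin
            required (x - 1ℚ) n
          ≤⟨ +-monoʳ-≤ (demand (suc n) - (x - 1ℚ)) (IH (s≤s (ℕP.m∸n≤m n δ))) ⟩
            demand (suc n) - (x - 1ℚ) + (total x j + rate x j)
          ≡⟨ lower-requirement (demand (suc n)) x (total x j) (rate x j) ⟩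
            (required x n + 1ℚ) + rate x j
          ≤⟨ bump ⟩
            total x (suc n) + rate x (suc n)
          ∎
          where open ≤-Reasoning

    greedy-objective : ∀ k y → objective Δ d k (greedy y) ≡ y * ℕ→ℚ k + total y d
    greedy-objective k y = cong (y * ℕ→ℚ k +_) (total-prefix y d)

    -- by greedy-feasible and total-minimal, the greedy solution is optimal iff its w₀
    -- minimises y ↦ y·k + total y d
    MinimalW₀ : ℕ → ℚ → Set
    MinimalW₀ k x = ∀ y → x * ℕ→ℚ k + total x d ≤ y * ℕ→ℚ k + total y d

    optimal⇒minimal : ∀ k x → Optimal Δ c k (greedy x) → MinimalW₀ k x
    optimal⇒minimal k x (_ , best) y =
      subst₂ _≤_ (greedy-objective k x) (greedy-objective k y) (best (greedy y) (greedy-feasible y))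

    minimal⇒optimal : ∀ k x → MinimalW₀ k x → Optimal Δ c k (greedy x)
    minimal⇒optimal k x minimal = greedy-feasible x , λ where
      (u₀ , u) feasible → subst (_≤ u₀ * ℕ→ℚ k + prefix u d) (sym (greedy-objective k x))
        (≤-trans (minimal u₀) (+-monoʳ-≤ (u₀ * ℕ→ℚ k) (total-minimal u₀ u feasible d ℕP.≤-refl)))

    greedy-optimal⇔ : ∀ k x → IsInt x →
                      Optimal Δ c k (greedy x) ⇔ (k ℕ.≤ count x d × count (x + 1ℚ) d ℕ.≤ k)
    greedy-optimal⇔ k x x-int = mk⇔
      (λ optimal → let minimal = optimal⇒minimal k x optimal in
          ℕ→ℚ-cancel-≤ (K≤rise-at-minimum φ K x A₁ (minimal (x - 1ℚ)) (total-unit-step x x-int d))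
        , ℕ→ℚ-cancel-≤ (drop≤K-at-minimum φ K x A₂ (minimal (x + 1ℚ)) drop-right))
      (λ (k≤count , count⁺≤k) → minimal⇒optimal k x
         (bracketed⇒minimal φ K x A₁ A₂ (λ y → total-support x y d) support-right
                            (ℕ→ℚ-mono-≤ count⁺≤k) (ℕ→ℚ-mono-≤ k≤count)))
      where
      K A₁ A₂ : ℚ
      K  = ℕ→ℚ k
      A₁ = rate x d
      A₂ = rate (x + 1ℚ) d
      φ : ℚ → ℚ
      φ y = total y d
      x+1-int : IsInt (x + 1ℚ)
      x+1-int = int-+ x-int (ℤ.+ 1 , refl)
      drop-right : φ (x + 1ℚ) + A₂ ≤ φ x
      drop-right = subst (_≤ φ x) (cong (φ (x + 1ℚ) +_) (trans (cong (A₂ *_) (unit-gap x)) (*-identityʳ A₂)))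
                         (total-support (x + 1ℚ) x d)
      rise-right : φ x ≤ φ (x + 1ℚ) + A₂
      rise-right = subst (λ z → total z d ≤ φ (x + 1ℚ) + A₂) (unit-back x)
                         (total-unit-step (x + 1ℚ) x+1-int d)
      support-right : Supports φ x A₂
      support-right = support-shift φ x A₂ (λ y → total-support (x + 1ℚ) y d) rise-right


open import Defs
open import Data.Nat using (ℕ; zero; suc; _≤_)
open import Data.Integer using (ℤ; _+_; +_)
open import Data.Vec using (Vec)
open import Data.List using (length)
open import Data.Rational using (ℚ)
open import Data.Product using (_×_; _,_)
open import Function.Bundles using (_⇔_)
open import Relation.Binary.PropositionalEquality using (refl; sym; trans; cong; subst₂)
open DualGreedy using (ℤ→ℚ-+; module Greedy)

lemma13 : (Δ : ℕ) → 1 ≤ Δ → (d' : ℕ) (c' : Vec ℕ d') (k' : ℕ) (v : ℤ) →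
    Optimal Δ c' k' (dualGreedy Δ c' v)
      ⇔ ((k' ≤ length (activeConstraints Δ c' (dualGreedy Δ c' v)))
         × (length (activeConstraints Δ c' (dualGreedy Δ c' (v + + 1))) ≤ k'))
lemma13 zero    ()
lemma13 (suc δ) _ d c k v =
  subst₂ (λ a b → Optimal (suc δ) c k (greedy x) ⇔ ((k ≤ a) × (b ≤ k)))
    (sym (activeConstraints-count x))
    (sym (trans (activeConstraints-count (ℤ→ℚ (v + + 1)))
                (cong (λ y → count y d) (sym (ℤ→ℚ-+ v (+ 1))))))
    (greedy-optimal⇔ k x (v , refl))
  where
  open Greedy δ c
  x : ℚ
  x = ℤ→ℚ v
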